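{- Let $\mathcal{M}_1$ and $\mathcal{M}_2$ be the G-models defined below. Then (1) $\mathcal{M}_1$ satisfies the condition $I(P,Q)$: for every state $u\in W_1$ there is $a\in D_1$ with $\mathbf{v}\Vdash_1 Pa$ and $u\not\Vdash_1 Qa$; and (2) $\mathcal{M}_2$ fails the condition $J(P,Q)$, i.e. it is not the case that for every state $u\in W_2$ there is $a\in D_2$ with $u\Vdash_2 Pa$ and $u\not\Vdash_2 Qa$.
   Context: Let $\mathbb{N}=\{0,1,2,\dots\}$, and for $k>0,l\geq0$ let $k\mathbb{N}+l=\{kn+l\mid n\in\mathbb{N}\}$. A quasi-partition is a triple $(A,B,C)$ of pairwise disjoint subsets of $\mathbb{N}$ with $A\cup B\cup C=\mathbb{N}$, $A$ and $C$ infinite, and $B$ either empty or infinite. Order quasi-partitions by $(A,B,C)\sqsubseteq(D,E,F)$ iff $A\subseteq D$ and $F\subseteq C$. Let $\mathbf{v}=(\mathbf{v}_1,\mathbf{v}_2,\mathbf{v}_3)=(3\mathbb{N},3\mathbb{N}+1,3\mathbb{N}+2)$ and $\mathbf{w}=(2\mathbb{N},\emptyset,2\mathbb{N}+1)$. $\mathcal{M}_1$ has base point $\mathbf{v}$ and states $W_1=\{(A,B,C)$ quasi-partition $\mid\mathbf{v}\sqsubseteq(A,B,C)$ and $B\cap\mathbf{v}_2$ infinite$\}$; $\mathcal{M}_2$ has base point $\mathbf{w}$ and states $W_2=\{(A,B,C)$ quasi-partition $\mid \mathbf{w}\sqsubseteq(A,B,C),\ B\neq\emptyset\}\cup\{\mathbf{w}\}$.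 Both are ordered by $\sqsubseteq$, have domain $D_1=D_2=\mathbb{N}$, and interpret unary predicates by: a state $u=(u_1,u_2,u_3)$ forces $Pa$ iff $a\in u_1\cup u_2$, and forces $Qa$ iff $a\in u_1$. $\Vdash_i$ denotes forcing (of atomic formulas) in $\mathcal{M}_i$. -}

module Defs where

open import Level using (0ℓ)
open import Data.Nat using (ℕ; _+_; _*_; _≤_)
open import Data.Product using (Σ; ∃; _×_; _,_)
open import Data.Sum using (_⊎_)
open import Data.Empty using (⊥)
open import Relation.Nullary using (¬_)
open import Relation.Binary.PropositionalEquality using (_≡_)
open import Relation.Unary using (Pred; _∈_; _∉_; _⊆_; _∪_; _∩_; ∅; _≐_)

Subset : Set₁
Subset = Pred ℕ 0ℓ

_ℕ+_ : ℕ → ℕ → Subset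
(k ℕ+ l) m = ∃ λ n → m ≡ k * n + l

Infinite : Subset → Set
Infinite X = ∀ b → ∃ λ m → b ≤ m × m ∈ X

IsEmpty : Subset → Set
IsEmpty X = ∀ m → m ∉ X

Triple : Set₁
Triple = Subset × Subset × Subset

π₁ π₂ π₃ : Triple → Subset
π₁ (A , _ , _) = A
π₂ (_ , B , _) = B
π₃ (_ , _ , C) = C

record IsQuasiPartition (u : Triple) : Set where
  field
    disj₁₂ : ∀ m → ¬ (m ∈ π₁ u × m ∈ π₂ u)
    disj₁₃ : ∀ m → ¬ (m ∈ π₁ u × m ∈ π₃ u)
    disj₂₃ : ∀ m → ¬ (m ∈ π₂ u × m ∈ π₃ u)
    cover  : ∀ m → m ∈ π₁ u ⊎ m ∈ π₂ u ⊎ m ∈ π₃ u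
    inf₁   : Infinite (π₁ u)
    inf₃   : Infinite (π₃ u)
    mid    : IsEmpty (π₂ u) ⊎ Infinite (π₂ u)

_⊑_ : Triple → Triple → Set
u ⊑ u' = (π₁ u ⊆ π₁ u') × (π₃ u' ⊆ π₃ u)

_≅_ : Triple → Triple → Set
u ≅ u' = (π₁ u ≐ π₁ u') × (π₂ u ≐ π₂ u') × (π₃ u ≐ π₃ u')

𝐯 : Triple
𝐯 = (3 ℕ+ 0) , (3 ℕ+ 1) , (3 ℕ+ 2)

𝐰 : Triple
𝐰 = (2 ℕ+ 0) , ∅ , (2 ℕ+ 1)

W₁ : Triple → Set
W₁ u = IsQuasiPartition u × 𝐯 ⊑ u × Infinite (π₂ u ∩ π₂ 𝐯)

W₂ : Triple → Set
W₂ u = (IsQuasiPartition u × 𝐰 ⊑ u × ¬ IsEmpty (π₂ u)) ⊎ u ≅ 𝐰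

-- forcing of atomic formulas (identical interpretation in M₁ and M₂)
ForcesP : Triple → ℕ → Set
ForcesP u a = a ∈ (π₁ u ∪ π₂ u)

ForcesQ : Triple → ℕ → Set
ForcesQ u a = a ∈ π₁ u

module Submission where

-- Both parts reduce to how the middle component B of a state decides
-- the gap between P (membership in A ∪ B) and Q (membership in A).
--
-- (1) For a quasi-partition u, any element of its middle component is
--     outside its first component, so u does not force Q there; if that
--     element also lies in the middle component of 𝐯, then 𝐯 forces P
--     there.  A state u ∈ W₁ has infinitely many (in particular, at
--     least one) elements in π₂ u ∩ π₂ 𝐯, which gives the witness.
-- (2) A triple with empty middle component forces Q wherever it forces P,
--     so it admits no witness for J(P,Q).  The base point 𝐰 is such a
--     triple and is itself a state of M₂, so J(P,Q) fails at 𝐰.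

open import Defs
open import Data.Nat using (ℕ)
open import Data.Product using (∃; _×_; _,_)
open import Data.Sum using (inj₁; inj₂)
open import Relation.Nullary using (¬_)
open import Relation.Unary using (_∈_)
open import Relation.Unary.Properties using (≐-refl)

infinite⇒inhabited : ∀ {X : Subset} → Infinite X → ∃ λ m → m ∈ X
infinite⇒inhabited inf with inf 0
... | m , _ , m∈X = m , m∈X

middle-separates : ∀ {u v : Triple} {m : ℕ} → IsQuasiPartition u →
                   m ∈ π₂ u → m ∈ π₂ v → ForcesP v m × ¬ ForcesQ u m
middle-separates {m = m} qp m∈u₂ m∈v₂ =
  inj₂ m∈v₂ , λ m∈u₁ → IsQuasiPartition.disj₁₂ qp m (m∈u₁ , m∈u₂)

M₁-satisfies-I : ∀ u → W₁ u → ∃ λ (a : ℕ) → ForcesP 𝐯 a × ¬ ForcesQ u a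
M₁-satisfies-I u (qp , _ , inf) with infinite⇒inhabited inf
... | m , (m∈u₂ , m∈𝐯₂) = m , middle-separates {v = 𝐯} qp m∈u₂ m∈𝐯₂

empty-middle⇒P⊆Q : ∀ {u : Triple} → IsEmpty (π₂ u) →
                   ∀ a → ForcesP u a → ForcesQ u a
empty-middle⇒P⊆Q _     a (inj₁ a∈u₁) = a∈u₁
empty-middle⇒P⊆Q empty a (inj₂ a∈u₂) with empty a a∈u₂
... | ()

𝐰∈W₂ : W₂ 𝐰
𝐰∈W₂ = inj₂ (≐-refl , ≐-refl , ≐-refl)

𝐰-has-no-gap : ¬ (∃ λ (a : ℕ) → ForcesP 𝐰 a × ¬ ForcesQ 𝐰 a)
𝐰-has-no-gap (a , Pa , ¬Qa) = ¬Qa (empty-middle⇒P⊆Q {𝐰} (λ _ ()) a Pa)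

lemma5p1 : (∀ u → W₁ u → ∃ λ (a : ℕ) → ForcesP 𝐯 a × ¬ ForcesQ u a)
           × ¬ (∀ u → W₂ u → ∃ λ (a : ℕ) → ForcesP u a × ¬ ForcesQ u a)
lemma5p1 = M₁-satisfies-I , λ J → 𝐰-has-no-gap (J 𝐰 𝐰∈W₂)
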